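{- Let $k\ge0$ and $1\le d'\le d$ be integers. Let $\gamma$ be the type of some element of $L_{d'+k+1,d'}$. Then for every $T\in L_{d+k+1,d}$ of type $\gamma$ and every $T'\in L_{d'+k+1,d'}$ of type $\gamma$, one has $\mu_{d+k+1,d}(T)=\mu_{d'+k+1,d'}(T')$.
   Context: For integers $n\ge 1$, $d\ge 0$: for a finite set $X$ put $\operatorname{codim}_d(X)=d+1-|X|$. For a family $T=\{T_1,\dots,T_l\}$ of distinct finite sets put $\rho_d(T)=\sum_i\operatorname{codim}_d(T_i)$ (with $\rho_d(\emptyset)=0$) and $D_d(T)=\operatorname{codim}_d(T_1\cap\dots\cap T_l)-\rho_d(T)$. Let $L_{n,d}$ be the set of families $T\subset 2^{\{1,\dots,n\}}$ such that $0\le|T_i|\le d$ for all $T_i\in T$ and $D_d(T')>0$ for every subfamily $T'\subset T$ with $|T'|>1$, ordered by: $T<T'$ iff $\rho_d(T)<\rho_d(T')$ and for every $T_i\in T$ there is $T'_j\in T'$ with $T'_j\subset T_i$. Its minimum $\hat0$ is the empty family. $\mu_{n,d}(T)=\mu(\hat0,T)$ is the Möbius function of $L_{n,d}$. The type of $T=\{T_1,\dots,T_l\}\in L_{n,d}$, listed so that $|T_1|\le\dots\le|T_l|$, is the partition $(\operatorname{codim}_d(T_1),\dots,\operatorname{codim}_d(T_l))$; the type of $\hat0$ is the empty partition. -}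

module Defs where

open import Data.Bool using (Bool; true; false)
import Data.Bool as Bool
open import Data.Nat as ℕ using (ℕ; zero; suc; _∸_)
open import Data.Nat.Properties using (≤-decTotalOrder)
open import Data.Integer as ℤ using (ℤ; +_; 0ℤ; 1ℤ; -_)
import Data.Integer.Properties as ℤP
open import Data.List using (List; []; _∷_; [_]; map; _++_; foldr; length; filter; reverse)
open import Data.List.Relation.Unary.All using (All; all?)
open import Data.List.Relation.Unary.Any using (Any; any?)
open import Data.List.Relation.Unary.AllPairs using (allPairs?)
open import Data.List.Relation.Unary.Unique.Propositional using (Unique)
open import Data.Fin.Subset using (Subset; inside; outside; ⊤; _∩_; ∣_∣; _⊆_)
open import Data.Fin.Subset.Properties using (_⊆?_)
open import Data.Vec using ([]; _∷_)
open import Data.Vec.Properties using (≡-dec)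
open import Data.Product using (_×_)
open import Relation.Nullary using (Dec; ¬?; _×-dec_; _→-dec_)
open import Relation.Unary using (Decidable)
import Data.List.Sort as Sort
open Sort ≤-decTotalOrder using (sort)

-- Subsets of {1,…,n} are modelled as subsets of Fin n; a family of
-- subsets is a list of subsets (distinctness is imposed in InL).

codim : ∀ {n} → ℕ → Subset n → ℤ
codim d X = + suc d ℤ.- + ∣ X ∣

ρ : ∀ {n} → ℕ → List (Subset n) → ℤ
ρ d T = foldr ℤ._+_ 0ℤ (map (codim d) T)

-- T_1 ∩ … ∩ T_l  (only used for l ≥ 2)
⋂ : ∀ {n} → List (Subset n) → Subset n
⋂ = foldr _∩_ ⊤

D : ∀ {n} → ℕ → List (Subset n) → ℤ
D d T = codim d (⋂ T) ℤ.- ρ d T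

subfamilies : ∀ {a} {A : Set a} → List A → List (List A)
subfamilies [] = [ [] ]
subfamilies (x ∷ xs) = subfamilies xs ++ map (x ∷_) (subfamilies xs)

allSubsets : (n : ℕ) → List (Subset n)
allSubsets zero = [ [] ]
allSubsets (suc n) = map (outside ∷_) (allSubsets n) ++ map (inside ∷_) (allSubsets n)

InL : (n d : ℕ) → List (Subset n) → Set
InL n d T =
  Unique T ×
  All (λ X → ∣ X ∣ ℕ.≤ d) T ×
  All (λ T' → 2 ℕ.≤ length T' → 0ℤ ℤ.< D d T') (subfamilies T)

inL? : ∀ n d → Decidable (InL n d)
inL? n d T =
  allPairs? (λ x y → ¬? (≡-dec Bool._≟_ x y)) T ×-dec
  (all? (λ X → ∣ X ∣ ℕ.≤? d) T ×-dec
   all? (λ T' → (2 ℕ.≤? length T') →-dec (0ℤ ℤ.<? D d T')) (subfamilies T))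

_<[_]_ : ∀ {n} → List (Subset n) → ℕ → List (Subset n) → Set
T <[ d ] T' = (ρ d T ℤ.< ρ d T') × All (λ Ti → Any (λ Tj → Tj ⊆ Ti) T') T

<? : ∀ {n} d (T T' : List (Subset n)) → Dec (T <[ d ] T')
<? d T T' = (ρ d T ℤ.<? ρ d T') ×-dec all? (λ Ti → any? (λ Tj → Tj ⊆? Ti) T') T

elemsL : (n d : ℕ) → List (List (Subset n))
elemsL n d = filter (inL? n d) (subfamilies (allSubsets n))

-- Möbius function μ(0̂,T) via μ(0̂,0̂) = 1 and
-- μ(0̂,T) = - Σ_{S ∈ L, S < T} μ(0̂,S) for T ≠ 0̂ (fuel-bounded recursion).
mobiusF : (n d : ℕ) → ℕ → List (Subset n) → ℤ
mobiusF n d zero T = 0ℤ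
mobiusF n d (suc f) [] = 1ℤ
mobiusF n d (suc f) (X ∷ T) =
  - foldr ℤ._+_ 0ℤ (map (mobiusF n d f) (filter (λ S → <? d S (X ∷ T)) (elemsL n d)))

-- μ_{n,d}(T); fuel exceeds the length of any chain in L_{n,d}
μ : (n d : ℕ) → List (Subset n) → ℤ
μ n d T = mobiusF n d (suc (length (elemsL n d))) T

-- type of T: the partition of the codimensions, listed in non-increasing
-- order (i.e. ordered by increasing |T_i|)
type : ∀ {n} → ℕ → List (Subset n) → List ℕ
type d T = reverse (sort (map (λ X → suc d ∸ ∣ X ∣) T))

-- Pair the members of T and T′ by codimension, as their types agree. Since n = d + k + 1,
-- paired members p, p′ also have complements of the same size k + codim, so the sets of
-- size ≤ d above p correspond to the sets of size ≤ d′ above p′ by keeping the positions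
-- outside the piece; this preserves codimension, inclusion and intersections. Every member
-- of a family below T lies above exactly one member of T, so the correspondence extends to
-- families; the defect condition is carried over because grouping a family by the pieces
-- below its members can only increase its defect. Hence the lower intervals of T and T′ in
-- L are isomorphic, and μ(0̂, T) = μ(0̂, T′) by induction over the lower interval.
module Submission where

open import Data.Bool as Bool using (Bool; true; false; _∧_; T?)
open import Data.Bool.Properties using (≤-minimum; ≤-maximum)
open import Data.Empty using (⊥; ⊥-elim)
open import Data.Fin.Subset using (Subset; inside; outside; ⊤; _∩_; _∪_; ∣_∣; _⊆_; ∁)
open import Data.Fin.Subset.Properties
  using (_⊆?_; ⊆⊤; ⊆-refl; ⊆-trans; drop-∷-⊆; out⊆; s⊆s; p⊆q⇒∣p∣≤∣q∣; ∣∁p∣≡n∸∣p∣;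
         p∩q⊆p; p∩q⊆q; x∈p∩q⁺; x∈p∪q⁻; p⊆p∪q; q⊆p∪q; ∩-assoc; ∩-identityˡ; ∩-identityʳ;
         ∩-isCommutativeMonoid)
open import Data.Integer as ℤ using (ℤ; +_; 0ℤ; _-_; -_)
import Data.Integer.Properties as ℤ
open import Data.Integer.Tactic.RingSolver using (solve-∀)
open import Data.List as List using (List; []; _∷_; _++_; [_]; length; filter; map; zipWith; replicate)
open import Data.List.Membership.Propositional using (_∈_; _∉_; lose; find)
open import Data.List.Membership.Propositional.Properties
  using (∈-++⁺ˡ; ∈-++⁺ʳ; ∈-++⁻; ∈-map⁺; ∈-map⁻; ∈-∃++; ∈-filter⁺; ∈-filter⁻)
open import Data.List.Properties
  using (∷-injectiveˡ; ∷-injectiveʳ; ++-identityʳ; partition-defn; map-cong-local; length-filter)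
open import Data.List.Relation.Binary.Equality.Propositional using (≋⇒≡)
open import Data.List.Relation.Binary.Permutation.Propositional using (_↭_; ↭⇒↭ₛ; ↭ₛ⇒↭)
import Data.List.Relation.Binary.Permutation.Propositional as ↭
import Data.List.Relation.Binary.Permutation.Propositional.Properties as ↭
import Data.List.Relation.Binary.Permutation.Setoid.Properties as ↭ₛ
open import Data.List.Relation.Binary.Pointwise as Pointwise
  using (Pointwise; []; _∷_; Pointwise-length; symmetric; ≡⇒Pointwise-≡)
open import Data.List.Relation.Binary.Sublist.Propositional as Sublist
  using ([]; _∷_; _∷ʳ_) renaming (_⊆_ to _⊑_)
import Data.List.Relation.Binary.Sublist.Propositional.Properties as Sublist
open import Data.List.Relation.Binary.Sublist.Propositional.Properties
  using () renaming (filter-⊆ to filter-⊑)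
open import Data.List.Relation.Unary.All as All using (All; []; _∷_)
import Data.List.Relation.Unary.All.Properties as All
open import Data.List.Relation.Unary.All.Properties using (All¬⇒¬Any; all-filter)
open import Data.List.Relation.Unary.Any as Any using (Any; here; there)
open import Data.List.Relation.Unary.Unique.Propositional using (Unique; []; _∷_)
import Data.List.Relation.Unary.Unique.Propositional.Properties as Unique
open import Data.Nat as ℕ using (ℕ; zero; suc)
import Data.Nat.Properties as ℕ
open import Data.List.Sort ℕ.≤-decTotalOrder using (sort; sort-↭)
open import Data.Product using (_×_; _,_; ∃; proj₁; proj₂)
open import Data.Product.Properties using (,-injectiveˡ; ,-injectiveʳ)
open import Data.Sum using (_⊎_; inj₁; inj₂)
import Data.Sum as ⊎
open import Data.Vec as Vec using ([]; _∷_)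
import Data.Vec.Properties as Vec
open import Function using (case_of_)
open import Relation.Binary using (DecidableEquality)
open import Relation.Binary.PropositionalEquality hiding ([_])
open import Relation.Nullary using (¬_; yes; no)
open import Relation.Unary using (Decidable)
open import Relation.Unary.Properties using (∁?)

open import Defs

private variable
  n d : ℕ
  p q r p′ q′ m x y : Subset n

-- Subsets and residues

⊆-∩⁺ : p ⊆ q → p ⊆ r → p ⊆ q ∩ r
⊆-∩⁺ p⊆q p⊆r i∈p = x∈p∩q⁺ (p⊆q i∈p , p⊆r i∈p)

∪-lub : p ⊆ r → q ⊆ r → p ∪ q ⊆ r
∪-lub {p = p} {q = q} p⊆r q⊆r i∈p∪q = ⊎.[ p⊆r , q⊆r ] (x∈p∪q⁻ p q i∈p∪q)

∪-mono : p ⊆ p′ → q ⊆ q′ → p ∪ q ⊆ p′ ∪ q′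
∪-mono {p′ = p′} {q′ = q′} p⊆p′ q⊆q′ =
  ∪-lub (⊆-trans p⊆p′ (p⊆p∪q q′)) (⊆-trans q⊆q′ (q⊆p∪q p′ q′))

in⊈out : ¬ (inside ∷ p ⊆ outside ∷ q)
in⊈out h with h Vec.here
... | ()

∣p∩q∣+∣p∪q∣≡∣p∣+∣q∣ : (p q : Subset n) → ∣ p ∩ q ∣ ℕ.+ ∣ p ∪ q ∣ ≡ ∣ p ∣ ℕ.+ ∣ q ∣
∣p∩q∣+∣p∪q∣≡∣p∣+∣q∣ [] [] = refl
∣p∩q∣+∣p∪q∣≡∣p∣+∣q∣ (true ∷ p) (true ∷ q) =
  cong suc (trans (ℕ.+-suc _ _) (trans (cong suc (∣p∩q∣+∣p∪q∣≡∣p∣+∣q∣ p q)) (sym (ℕ.+-suc _ _))))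
∣p∩q∣+∣p∪q∣≡∣p∣+∣q∣ (true ∷ p) (false ∷ q) =
  trans (ℕ.+-suc _ _) (cong suc (∣p∩q∣+∣p∪q∣≡∣p∣+∣q∣ p q))
∣p∩q∣+∣p∪q∣≡∣p∣+∣q∣ (false ∷ p) (true ∷ q) =
  trans (ℕ.+-suc _ _) (trans (cong suc (∣p∩q∣+∣p∪q∣≡∣p∣+∣q∣ p q)) (sym (ℕ.+-suc _ _)))
∣p∩q∣+∣p∪q∣≡∣p∣+∣q∣ (false ∷ p) (false ∷ q) = ∣p∩q∣+∣p∪q∣≡∣p∣+∣q∣ p q

Refines : List (Subset n) → List (Subset n) → Set
Refines Ps B = All (λ Y → Any (_⊆ Y) Ps) B

Refines-singleton⇒above : ∀ {q} {B : List (Subset n)} → Refines [ q ] B → All (q ⊆_) B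
Refines-singleton⇒above []                 = []
Refines-singleton⇒above (here q⊆Y ∷ q≼B) = q⊆Y ∷ Refines-singleton⇒above q≼B

Refines-refl : (T : List (Subset n)) → Refines T T
Refines-refl T = All.tabulate (λ Y∈T → lose Y∈T ⊆-refl)

Any-⊆-trans : ∀ {Ps : List (Subset n)} {Y Z} → Any (_⊆ Y) Ps → Y ⊆ Z → Any (_⊆ Z) Ps
Any-⊆-trans (here X⊆Y)  Y⊆Z = here (⊆-trans X⊆Y Y⊆Z)
Any-⊆-trans (there X≼Y) Y⊆Z = there (Any-⊆-trans X≼Y Y⊆Z)

Refines-< : ∀ {d} {Ps U S : List (Subset n)} → U <[ d ] S → Refines Ps S → Refines Ps U
Refines-< (_ , S≼U) Ps≼S = All.map Ps≼Y S≼U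
  where
  Ps≼Y : ∀ {Y} → Any (_⊆ Y) _ → Any (_⊆ Y) _
  Ps≼Y S≼Y with Z , Z∈S , Z⊆Y ← find S≼Y = Any-⊆-trans (All.lookup Ps≼S Z∈S) Z⊆Y

⋂-greatest : ∀ {q} {B : List (Subset n)} → All (q ⊆_) B → q ⊆ ⋂ B
⋂-greatest []             = ⊆⊤
⋂-greatest (q⊆Y ∷ q⊆B) = ⊆-∩⁺ q⊆Y (⋂-greatest q⊆B)

⋂-lower : ∀ {Y} {J : List (Subset n)} → Any (_⊆ Y) J → ⋂ J ⊆ Y
⋂-lower {J = X ∷ J} (here X⊆Y)  = ⊆-trans (p∩q⊆p X (⋂ J)) X⊆Y
⋂-lower {J = X ∷ J} (there J⊆Y) = ⊆-trans (p∩q⊆q X (⋂ J)) (⋂-lower J⊆Y)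

⋂-refines : {J B : List (Subset n)} → Refines J B → ⋂ J ⊆ ⋂ B
⋂-refines J≼B = ⋂-greatest (All.map ⋂-lower J≼B)

-- The bits of y outside m: over a fixed m ⊆ y a faithful coordinate system for y.
residue : Subset n → Subset n → List Bool
residue []           []      = []
residue (true  ∷ m) (_ ∷ y) = residue m y
residue (false ∷ m) (b ∷ y) = b ∷ residue m y

extend : Subset n → List Bool → Subset n
extend []           _        = []
extend (true  ∷ m) bs       = inside ∷ extend m bs
extend (false ∷ m) []       = outside ∷ extend m []
extend (false ∷ m) (b ∷ bs) = b ∷ extend m bs

weight : List Bool → ℕ
weight bs = length (filter T? bs)

length-residue : (m y : Subset n) → length (residue m y) ≡ ∣ ∁ m ∣
length-residue []          []      = refl
length-residue (true  ∷ m) (_ ∷ y) = length-residue m y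
length-residue (false ∷ m) (_ ∷ y) = cong suc (length-residue m y)

∣y∣≡∣m∣+weight : m ⊆ y → ∣ y ∣ ≡ ∣ m ∣ ℕ.+ weight (residue m y)
∣y∣≡∣m∣+weight {m = []}         {[]}         _ = refl
∣y∣≡∣m∣+weight {m = true  ∷ m} {true  ∷ y} h = cong suc (∣y∣≡∣m∣+weight (drop-∷-⊆ h))
∣y∣≡∣m∣+weight {m = true  ∷ m} {false ∷ y} h = ⊥-elim (in⊈out h)
∣y∣≡∣m∣+weight {m = false ∷ m} {true  ∷ y} h =
  trans (cong suc (∣y∣≡∣m∣+weight (drop-∷-⊆ h))) (sym (ℕ.+-suc _ _))
∣y∣≡∣m∣+weight {m = false ∷ m} {false ∷ y} h = ∣y∣≡∣m∣+weight (drop-∷-⊆ h)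

residue-∩ : (m x y : Subset n) → residue m (x ∩ y) ≡ zipWith _∧_ (residue m x) (residue m y)
residue-∩ []          []      []      = refl
residue-∩ (true  ∷ m) (_ ∷ x) (_ ∷ y) = residue-∩ m x y
residue-∩ (false ∷ m) (a ∷ x) (b ∷ y) = cong (a ∧ b ∷_) (residue-∩ m x y)

residue-⊤ : (m : Subset n) → residue m ⊤ ≡ replicate ∣ ∁ m ∣ true
residue-⊤ []          = refl
residue-⊤ (true  ∷ m) = residue-⊤ m
residue-⊤ (false ∷ m) = cong (true ∷_) (residue-⊤ m)

residue-self : (m : Subset n) → residue m m ≡ replicate ∣ ∁ m ∣ false
residue-self []          = refl
residue-self (true  ∷ m) = residue-self m
residue-self (false ∷ m) = cong (false ∷_) (residue-self m)

residue-injective : m ⊆ x → m ⊆ y → residue m x ≡ residue m y → x ≡ y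
residue-injective {m = []} {[]} {[]} _ _ _ = refl
residue-injective {m = true ∷ m} {true ∷ x} {true ∷ y} hx hy e =
  cong (true ∷_) (residue-injective (drop-∷-⊆ hx) (drop-∷-⊆ hy) e)
residue-injective {m = true ∷ m} {false ∷ x} hx _ _ = ⊥-elim (in⊈out hx)
residue-injective {m = true ∷ m} {true ∷ x} {false ∷ y} _ hy _ = ⊥-elim (in⊈out hy)
residue-injective {m = false ∷ m} {a ∷ x} {b ∷ y} hx hy e with refl ← ∷-injectiveˡ e =
  cong (a ∷_) (residue-injective (drop-∷-⊆ hx) (drop-∷-⊆ hy) (∷-injectiveʳ e))

∷-⊆ : ∀ {a b} → a Bool.≤ b → p ⊆ q → a ∷ p ⊆ b ∷ q
∷-⊆ Bool.f≤t p⊆q = out⊆ p⊆q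
∷-⊆ Bool.b≤b p⊆q = s⊆s p⊆q

residue-mono : x ⊆ y → Pointwise Bool._≤_ (residue m x) (residue m y)
residue-mono {x = []} {[]} {[]} _ = []
residue-mono {x = _ ∷ x} {_ ∷ y} {true ∷ m} h = residue-mono {m = m} (drop-∷-⊆ h)
residue-mono {x = false ∷ x} {_ ∷ y} {false ∷ m} h = ≤-minimum _ ∷ residue-mono {m = m} (drop-∷-⊆ h)
residue-mono {x = true ∷ x} {true ∷ y} {false ∷ m} h = Bool.b≤b ∷ residue-mono {m = m} (drop-∷-⊆ h)
residue-mono {x = true ∷ x} {false ∷ y} {false ∷ m} h = ⊥-elim (in⊈out h)

residue-mono⁻ : m ⊆ y → Pointwise Bool._≤_ (residue m x) (residue m y) → x ⊆ y
residue-mono⁻ {m = []} {[]} {[]} _ _ = λ ()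
residue-mono⁻ {m = true ∷ m} {true ∷ y} {_ ∷ x} h le = ∷-⊆ (≤-maximum _) (residue-mono⁻ (drop-∷-⊆ h) le)
residue-mono⁻ {m = true ∷ m} {false ∷ y} h _ = ⊥-elim (in⊈out h)
residue-mono⁻ {m = false ∷ m} {_ ∷ y} {_ ∷ x} h (a≤b ∷ le) = ∷-⊆ a≤b (residue-mono⁻ (drop-∷-⊆ h) le)

⊆-extend : (m : Subset n) (bs : List Bool) → m ⊆ extend m bs
⊆-extend []          _        = λ ()
⊆-extend (true  ∷ m) bs       = s⊆s (⊆-extend m bs)
⊆-extend (false ∷ m) []       = out⊆ (⊆-extend m [])
⊆-extend (false ∷ m) (b ∷ bs) = out⊆ (⊆-extend m bs)

residue-extend : (m : Subset n) (bs : List Bool) → length bs ≡ ∣ ∁ m ∣ → residue m (extend m bs) ≡ bs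
residue-extend []          []       _ = refl
residue-extend (true  ∷ m) bs       e = residue-extend m bs e
residue-extend (false ∷ m) (b ∷ bs) e = cong (b ∷_) (residue-extend m bs (ℕ.suc-injective e))

-- Codimension and defect

module _ where
  open import Data.Integer using (_+_)

  codim-∩ : ∀ d (X Y : Subset n) → codim d (X ∩ Y) ≡ codim d X + codim d Y + (+ ∣ X ∪ Y ∣ - + suc d)
  codim-∩ d X Y = begin
    s - i                              ≡⟨ regroup s a b i u ⟩
    rhs + ((a + b) - (i + u))          ≡⟨ cong (λ t → rhs + ((a + b) - t)) i+u≡a+b ⟩
    rhs + ((a + b) - (a + b))          ≡⟨ cong (λ t → rhs + t) (ℤ.+-inverseʳ (a + b)) ⟩
    rhs + 0ℤ                           ≡⟨ ℤ.+-identityʳ rhs ⟩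
    rhs                                ∎
    where
    open ≡-Reasoning
    s = + suc d; a = + ∣ X ∣; b = + ∣ Y ∣; i = + ∣ X ∩ Y ∣; u = + ∣ X ∪ Y ∣
    rhs = (s - a) + (s - b) + (u - s)
    regroup : ∀ s a b i u → s - i ≡ (s - a) + (s - b) + (u - s) + ((a + b) - (i + u))
    regroup = solve-∀
    i+u≡a+b : i + u ≡ a + b
    i+u≡a+b = begin
      i + u                     ≡⟨ ℤ.pos-+ ∣ X ∩ Y ∣ ∣ X ∪ Y ∣ ⟨
      + (∣ X ∩ Y ∣ ℕ.+ ∣ X ∪ Y ∣) ≡⟨ cong +_ (∣p∩q∣+∣p∪q∣≡∣p∣+∣q∣ X Y) ⟩
      + (∣ X ∣ ℕ.+ ∣ Y ∣)        ≡⟨ ℤ.pos-+ ∣ X ∣ ∣ Y ∣ ⟩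
      a + b                     ∎

  ρ-++ : ∀ d (xs ys : List (Subset n)) → ρ d (xs ++ ys) ≡ ρ d xs + ρ d ys
  ρ-++ d []       ys = sym (ℤ.+-identityˡ (ρ d ys))
  ρ-++ d (x ∷ xs) ys =
    trans (cong (λ t → codim d x + t) (ρ-++ d xs ys)) (sym (ℤ.+-assoc (codim d x) (ρ d xs) (ρ d ys)))

  ⋂-++ : (xs ys : List (Subset n)) → ⋂ (xs ++ ys) ≡ ⋂ xs ∩ ⋂ ys
  ⋂-++ []       ys = sym (∩-identityˡ (⋂ ys))
  ⋂-++ (x ∷ xs) ys = trans (cong (x ∩_) (⋂-++ xs ys)) (sym (∩-assoc x (⋂ xs) (⋂ ys)))

  D-++ : ∀ d (xs ys : List (Subset n)) →
         D d (xs ++ ys) ≡ D d xs + D d ys + (+ ∣ ⋂ xs ∪ ⋂ ys ∣ - + suc d)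
  D-++ d xs ys = begin
    codim d (⋂ (xs ++ ys)) - ρ d (xs ++ ys)
      ≡⟨ cong₂ (λ X r → codim d X - r) (⋂-++ xs ys) (ρ-++ d xs ys) ⟩
    codim d (⋂ xs ∩ ⋂ ys) - (ρ d xs + ρ d ys)
      ≡⟨ cong (_- (ρ d xs + ρ d ys)) (codim-∩ d (⋂ xs) (⋂ ys)) ⟩
    codim d (⋂ xs) + codim d (⋂ ys) + c - (ρ d xs + ρ d ys)
      ≡⟨ regroup (codim d (⋂ xs)) (codim d (⋂ ys)) c (ρ d xs) (ρ d ys) ⟩
    D d xs + D d ys + c ∎
    where
    open ≡-Reasoning
    c = + ∣ ⋂ xs ∪ ⋂ ys ∣ - + suc d
    regroup : ∀ a b c r s → a + b + c - (r + s) ≡ (a - r) + (b - s) + c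
    regroup = solve-∀

  ⋂-[_] : (X : Subset n) → ⋂ [ X ] ≡ X
  ⋂-[ X ] = ∩-identityʳ X

  D-[_] : (X : Subset n) → D d [ X ] ≡ 0ℤ
  D-[_] {d = d} X = begin
    codim d (⋂ [ X ]) - (codim d X + 0ℤ) ≡⟨ cong (λ Y → codim d Y - (codim d X + 0ℤ)) ⋂-[ X ] ⟩
    codim d X - (codim d X + 0ℤ)         ≡⟨ cancel (codim d X) ⟩
    0ℤ                                   ∎
    where
    open ≡-Reasoning
    cancel : ∀ c → c - (c + 0ℤ) ≡ 0ℤ
    cancel = solve-∀

  0<i-j⇒j<i : ∀ {i j} → 0ℤ ℤ.< i - j → j ℤ.< i
  0<i-j⇒j<i {i} {j} 0<i-j = subst₂ ℤ._<_ (ℤ.+-identityˡ j) (i-j+j≡i i j) (ℤ.+-monoˡ-< j 0<i-j)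
    where
    i-j+j≡i : ∀ i j → i - j + j ≡ i
    i-j+j≡i = solve-∀

  D-pair : ∀ d (X Y : Subset n) → 0ℤ ℤ.< D d (X ∷ Y ∷ []) → suc d ℕ.< ∣ X ∪ Y ∣
  D-pair d X Y 0<D = ℤ.drop‿+<+ (0<i-j⇒j<i (subst (0ℤ ℤ.<_) D[X,Y]≡ 0<D))
    where
    open ≡-Reasoning
    c = + ∣ ⋂ [ X ] ∪ ⋂ [ Y ] ∣ - + suc d
    D[X,Y]≡ : D d (X ∷ Y ∷ []) ≡ + ∣ X ∪ Y ∣ - + suc d
    D[X,Y]≡ = begin
      D d ([ X ] ++ [ Y ])
        ≡⟨ D-++ d [ X ] [ Y ] ⟩
      D d [ X ] + D d [ Y ] + (+ ∣ ⋂ [ X ] ∪ ⋂ [ Y ] ∣ - + suc d)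
        ≡⟨ cong₂ (λ a b → a + b + c) (D-[ X ]) (D-[ Y ]) ⟩
      0ℤ + 0ℤ + c
        ≡⟨ ℤ.+-identityˡ c ⟩
      + ∣ ⋂ [ X ] ∪ ⋂ [ Y ] ∣ - + suc d
        ≡⟨ cong₂ (λ A B → + ∣ A ∪ B ∣ - + suc d) ⋂-[ X ] ⋂-[ Y ] ⟩
      + ∣ X ∪ Y ∣ - + suc d ∎

  ρ-↭ : ∀ d {xs ys : List (Subset n)} → xs ↭ ys → ρ d xs ≡ ρ d ys
  ρ-↭ d xs↭ys = ↭ₛ.foldr-commMonoid (setoid ℤ) ℤ.+-0-isCommutativeMonoid (↭⇒↭ₛ (↭.map⁺ (codim d) xs↭ys))

  ⋂-↭ : {xs ys : List (Subset n)} → xs ↭ ys → ⋂ xs ≡ ⋂ ys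
  ⋂-↭ {n = n} xs↭ys = ↭ₛ.foldr-commMonoid (setoid (Subset n)) (∩-isCommutativeMonoid n) (↭⇒↭ₛ xs↭ys)

  D-↭ : ∀ d {xs ys : List (Subset n)} → xs ↭ ys → D d xs ≡ D d ys
  D-↭ d xs↭ys = cong₂ (λ X r → codim d X - r) (⋂-↭ xs↭ys) (ρ-↭ d xs↭ys)

  codim≡+∸ : ∀ d (X : Subset n) → ∣ X ∣ ℕ.≤ suc d → codim d X ≡ + (suc d ℕ.∸ ∣ X ∣)
  codim≡+∸ d X |X|≤1+d = trans (ℤ.[+m]-[+n]≡m⊖n (suc d) ∣ X ∣) (ℤ.⊖-≥ |X|≤1+d)

  bounded⇒0<codim : ∀ d (X : Subset n) → ∣ X ∣ ℕ.≤ d → 0ℤ ℤ.< codim d X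
  bounded⇒0<codim d X |X|≤d =
    subst (0ℤ ℤ.<_) (sym (codim≡+∸ d X (ℕ.m≤n⇒m≤1+n |X|≤d))) (ℤ.+<+ (ℕ.m<n⇒0<n∸m (ℕ.s≤s |X|≤d)))

  0<codim⇒bounded : ∀ d (X : Subset n) → 0ℤ ℤ.< codim d X → ∣ X ∣ ℕ.≤ d
  0<codim⇒bounded d X 0<codim = ℕ.s≤s⁻¹ (ℤ.drop‿+<+ (0<i-j⇒j<i 0<codim))

  codim-above : ∀ d {p Y : Subset n} → p ⊆ Y → codim d Y ≡ codim d p - + weight (residue p Y)
  codim-above d {p} {Y} p⊆Y = begin
    + suc d - + ∣ Y ∣                                ≡⟨ cong (λ k → + suc d - + k) (∣y∣≡∣m∣+weight p⊆Y) ⟩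
    + suc d - + (∣ p ∣ ℕ.+ w)                          ≡⟨ cong (λ k → + suc d - k) (ℤ.pos-+ ∣ p ∣ w) ⟩
    + suc d - (+ ∣ p ∣ + + w)                         ≡⟨ regroup (+ suc d) (+ ∣ p ∣) (+ w) ⟩
    + suc d - + ∣ p ∣ - + w                           ∎
    where
    open ≡-Reasoning
    w = weight (residue p Y)
    regroup : ∀ s a b → s - (a + b) ≡ s - a - b
    regroup = solve-∀

  D-∷≤D-++ : ∀ d {p} {J G R : List (Subset n)} → All (p ⊆_) G → ⋂ J ⊆ ⋂ R →
             0ℤ ℤ.≤ D d G → D d J ℤ.≤ D d R → D d (p ∷ J) ℤ.≤ D d (G ++ R)
  D-∷≤D-++ d {p} {J} {G} {R} p⊆G ⋂J⊆⋂R 0≤DG DJ≤DR = begin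
    D d ([ p ] ++ J)
      ≡⟨ D-++ d [ p ] J ⟩
    D d [ p ] + D d J + (+ ∣ ⋂ [ p ] ∪ ⋂ J ∣ - s)
      ≡⟨ cong₂ (λ a X → a + D d J + (+ ∣ X ∪ ⋂ J ∣ - s)) D-[ p ] ⋂-[ p ] ⟩
    0ℤ + D d J + (+ ∣ p ∪ ⋂ J ∣ - s)
      ≤⟨ ℤ.+-mono-≤ (ℤ.+-mono-≤ 0≤DG DJ≤DR) (ℤ.+-monoˡ-≤ (- s) (ℤ.+≤+ span≤)) ⟩
    D d G + D d R + (+ ∣ ⋂ G ∪ ⋂ R ∣ - s)
      ≡⟨ D-++ d G R ⟨
    D d (G ++ R) ∎
    where
    open ℤ.≤-Reasoning
    s = + suc d
    span≤ : ∣ p ∪ ⋂ J ∣ ℕ.≤ ∣ ⋂ G ∪ ⋂ R ∣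
    span≤ = p⊆q⇒∣p∣≤∣q∣ (∪-mono (⋂-greatest p⊆G) ⋂J⊆⋂R)

pair-⊑ : {A : Set} {x y : A} {xs : List A} → x ∈ xs → y ∈ xs → x ≢ y →
         x ∷ y ∷ [] ⊑ xs ⊎ y ∷ x ∷ [] ⊑ xs
pair-⊑ (here refl) (here refl) x≢y = ⊥-elim (x≢y refl)
pair-⊑ (here refl) (there y∈)  _   = inj₁ (refl ∷ Sublist.from∈ y∈)
pair-⊑ (there x∈)  (here refl) _   = inj₂ (refl ∷ Sublist.from∈ x∈)
pair-⊑ (there x∈)  (there y∈)  x≢y = ⊎.map (_ ∷ʳ_) (_ ∷ʳ_) (pair-⊑ x∈ y∈ x≢y)

⊑-resp-↭ : {A : Set} {xs ys zs : List A} → xs ⊑ ys → ys ↭ zs → ∃ λ ws → ws ⊑ zs × xs ↭ ws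
⊑-resp-↭ xs⊑ys ↭.refl = _ , xs⊑ys , ↭.refl
⊑-resp-↭ (y ∷ʳ xs⊑ys) (↭.prep _ ys↭zs) =
  let ws , ws⊑ , xs↭ws = ⊑-resp-↭ xs⊑ys ys↭zs in ws , y ∷ʳ ws⊑ , xs↭ws
⊑-resp-↭ (refl ∷ xs⊑ys) (↭.prep x ys↭zs) =
  let ws , ws⊑ , xs↭ws = ⊑-resp-↭ xs⊑ys ys↭zs in x ∷ ws , refl ∷ ws⊑ , ↭.prep x xs↭ws
⊑-resp-↭ (x ∷ʳ (y ∷ʳ xs⊑ys)) (↭.swap _ _ ys↭zs) =
  let ws , ws⊑ , xs↭ws = ⊑-resp-↭ xs⊑ys ys↭zs in ws , y ∷ʳ (x ∷ʳ ws⊑) , xs↭ws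
⊑-resp-↭ (x ∷ʳ (refl ∷ xs⊑ys)) (↭.swap _ y ys↭zs) =
  let ws , ws⊑ , xs↭ws = ⊑-resp-↭ xs⊑ys ys↭zs in y ∷ ws , refl ∷ (x ∷ʳ ws⊑) , ↭.prep y xs↭ws
⊑-resp-↭ (refl ∷ (y ∷ʳ xs⊑ys)) (↭.swap x _ ys↭zs) =
  let ws , ws⊑ , xs↭ws = ⊑-resp-↭ xs⊑ys ys↭zs in x ∷ ws , y ∷ʳ (refl ∷ ws⊑) , ↭.prep x xs↭ws
⊑-resp-↭ (refl ∷ (refl ∷ xs⊑ys)) (↭.swap x y ys↭zs) =
  let ws , ws⊑ , xs↭ws = ⊑-resp-↭ xs⊑ys ys↭zs in y ∷ x ∷ ws , refl ∷ (refl ∷ ws⊑) , ↭.swap x y xs↭ws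
⊑-resp-↭ xs⊑ys (↭.trans ys↭ys′ ys′↭zs) =
  let vs , vs⊑ , xs↭vs = ⊑-resp-↭ xs⊑ys ys↭ys′
      ws , ws⊑ , vs↭ws = ⊑-resp-↭ vs⊑ ys′↭zs
  in ws , ws⊑ , ↭.trans xs↭vs vs↭ws

filter-partition-↭ : {A : Set} {P : A → Set} (P? : Decidable P) (xs : List A) →
                     xs ↭ filter P? xs ++ filter (∁? P?) xs
filter-partition-↭ P? xs =
  subst (λ (ys , zs) → xs ↭ ys ++ zs) (partition-defn P? xs) (↭ₛ⇒↭ (↭ₛ.partition-↭ (setoid _) P? xs))

module _ {A : Set} where

  private variable
    a b : A
    xs ys zs : List A

  ∈⇒↭∷ : a ∈ ys → ∃ λ zs → ys ↭ a ∷ zs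
  ∈⇒↭∷ y∈ys with hd , tl , refl ← ∈-∃++ y∈ys = hd ++ tl , ↭.shift _ hd tl

  Unique-↭∷ : Unique ys → ys ↭ a ∷ zs → a ∉ zs × Unique zs
  Unique-↭∷ u ys↭y∷zs with y≢zs ∷ u′ ← ↭ₛ.Unique-resp-↭ (setoid _) (↭⇒↭ₛ ys↭y∷zs) u = All¬⇒¬Any y≢zs , u′

  Unique-same-∈⇒↭ : Unique xs → Unique ys →
                    (∀ {v} → v ∈ xs → v ∈ ys) → (∀ {v} → v ∈ ys → v ∈ xs) → xs ↭ ys
  Unique-same-∈⇒↭ {[]} {[]}    _ _ _ _ = ↭.refl
  Unique-same-∈⇒↭ {[]} {_ ∷ _} _ _ _ to = case to (here refl) of λ ()
  Unique-same-∈⇒↭ {a ∷ xs} {ys} (a≢xs ∷ uxs) uys from to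
    with rest , ys↭a∷rest ← ∈⇒↭∷ (from (here refl))
    with a∉rest , urest ← Unique-↭∷ uys ys↭a∷rest =
    ↭.trans (↭.prep a (Unique-same-∈⇒↭ uxs urest from′ to′)) (↭.↭-sym ys↭a∷rest)
    where
    from′ : ∀ {v} → v ∈ xs → v ∈ rest
    from′ v∈xs with ↭.∈-resp-↭ ys↭a∷rest (from (there v∈xs))
    ... | here refl  = ⊥-elim (All¬⇒¬Any a≢xs v∈xs)
    ... | there v∈rest = v∈rest
    to′ : ∀ {v} → v ∈ rest → v ∈ xs
    to′ v∈rest with to (↭.∈-resp-↭ (↭.↭-sym ys↭a∷rest) (there v∈rest))
    ... | here refl  = ⊥-elim (a∉rest v∈rest)
    ... | there v∈xs = v∈xs

  Unique-map-injective : {C : Set} {f : A → C} {xs : List A} {x y : A} →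
                         Unique (map f xs) → x ∈ xs → y ∈ xs → f x ≡ f y → x ≡ y
  Unique-map-injective                 _         (here refl) (here refl) _     = refl
  Unique-map-injective {f = f} {_ ∷ xs} (fx≢ ∷ _) (here refl) (there y∈)  fx≡fy =
    ⊥-elim (All¬⇒¬Any fx≢ (subst (_∈ map f xs) (sym fx≡fy) (∈-map⁺ f y∈)))
  Unique-map-injective {f = f} {_ ∷ xs} (fy≢ ∷ _) (there x∈)  (here refl) fx≡fy =
    ⊥-elim (All¬⇒¬Any fy≢ (subst (_∈ map f xs) fx≡fy (∈-map⁺ f x∈)))
  Unique-map-injective                 (_ ∷ u)   (there x∈)  (there y∈)  fx≡fy =
    Unique-map-injective u x∈ y∈ fx≡fy

  ⊑-representative : DecidableEquality A → Unique zs → Unique ys → (∀ {v} → v ∈ ys → v ∈ zs) →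
                     ∃ λ xs → xs ⊑ zs × xs ↭ ys
  ⊑-representative {zs} {ys} _≟_ uzs uys ys⊆zs =
    filter ∈ys? zs , filter-⊑ ∈ys? zs ,
    Unique-same-∈⇒↭ (Unique.filter⁺ ∈ys? uzs) uys (λ v∈ → proj₂ (∈-filter⁻ ∈ys? {xs = zs} v∈))
                    (λ v∈ys → ∈-filter⁺ ∈ys? (ys⊆zs v∈ys) v∈ys)
    where
    ∈ys? : Decidable (_∈ ys)
    ∈ys? v = Any.any? (v ≟_) ys

  ⊑-same-∈⇒≡ : Unique zs → xs ⊑ zs → ys ⊑ zs →
               (∀ {v} → v ∈ xs → v ∈ ys) → (∀ {v} → v ∈ ys → v ∈ xs) → xs ≡ ys
  ⊑-same-∈⇒≡ _             []             []             _    _  = refl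
  ⊑-same-∈⇒≡ (_ ∷ u)       (_ ∷ʳ xs⊑)     (_ ∷ʳ ys⊑)     from to = ⊑-same-∈⇒≡ u xs⊑ ys⊑ from to
  ⊑-same-∈⇒≡ (a≢zs ∷ _)    (_ ∷ʳ xs⊑)     (refl ∷ _)     _    to =
    ⊥-elim (All¬⇒¬Any a≢zs (Sublist.lookup xs⊑ (to (here refl))))
  ⊑-same-∈⇒≡ (a≢zs ∷ _)    (refl ∷ _)     (_ ∷ʳ ys⊑)     from _  =
    ⊥-elim (All¬⇒¬Any a≢zs (Sublist.lookup ys⊑ (from (here refl))))
  ⊑-same-∈⇒≡ (a≢zs ∷ u)    (refl ∷ xs⊑)   (refl ∷ ys⊑)   from to =
    cong (_ ∷_) (⊑-same-∈⇒≡ u xs⊑ ys⊑ (drop from xs⊑) (drop to ys⊑))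
    where
    drop : ∀ {us vs} → (∀ {v} → v ∈ _ ∷ us → v ∈ _ ∷ vs) → us ⊑ _ → ∀ {v} → v ∈ us → v ∈ vs
    drop f us⊑ v∈us with f (there v∈us)
    ... | here refl   = ⊥-elim (All¬⇒¬Any a≢zs (Sublist.lookup us⊑ v∈us))
    ... | there v∈vs = v∈vs

length-filter-< : {A : Set} {P Q : A → Set} (P? : Decidable P) (Q? : Decidable Q) {xs : List A} {a : A} →
                  (∀ {x} → P x → Q x) → a ∈ xs → Q a → ¬ P a →
                  length (filter P? xs) ℕ.< length (filter Q? xs)
length-filter-< P? Q? {xs} P⇒Q a∈xs Qa ¬Pa = ℕ.≤∧≢⇒< (Sublist.length-mono-≤ filterP⊑filterQ) lengths≢
  where
  filterP⊑filterQ = Sublist.filter⁺ P? Q? (λ { refl → P⇒Q }) (Sublist.⊆-refl {x = xs})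
  lengths≢ : length (filter P? xs) ≢ length (filter Q? xs)
  lengths≢ |P|≡|Q| = ¬Pa (proj₂ (∈-filter⁻ P? {xs = xs}
    (subst (_ ∈_) (sym (≋⇒≡ (Sublist.to-≋ |P|≡|Q| filterP⊑filterQ))) (∈-filter⁺ Q? a∈xs Qa))))

sumℤ : List ℤ → ℤ
sumℤ = List.foldr ℤ._+_ 0ℤ

record Related {A B : Set} (R : A → B → Set) (xs : List A) (ys : List B) : Set where
  field
    forth : ∀ {x} → x ∈ xs → ∃ λ y → y ∈ ys × R x y
    back  : ∀ {y} → y ∈ ys → ∃ λ x → x ∈ xs × R x y

Related-swap : {A B : Set} {R : A → B → Set} {S : B → A → Set} {xs : List A} {ys : List B} →
               (∀ {x y} → R x y → S y x) → Related R xs ys → Related S ys xs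
Related-swap R⇒S rel = record
  { forth = λ y∈ → let x , x∈ , Rxy = back y∈ in x , x∈ , R⇒S Rxy
  ; back  = λ x∈ → let y , y∈ , Rxy = forth x∈ in y , y∈ , R⇒S Rxy
  }
  where open Related rel

record Bijection {A B : Set} (R : A → B → Set) (xs : List A) (ys : List B) : Set where
  field
    related    : Related R xs ys
    functional : ∀ {x y y′} → x ∈ xs → y ∈ ys → y′ ∈ ys → R x y → R x y′ → y ≡ y′
    injective  : ∀ {x x′ y} → x ∈ xs → x′ ∈ xs → y ∈ ys → R x y → R x′ y → x ≡ x′
  open Related related public

module _ {A B : Set} {R : A → B → Set} where
  open import Data.Integer using (_+_)

  Bijection-remove : ∀ {x y xs ys rest} → Unique (x ∷ xs) → Bijection R (x ∷ xs) ys →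
                     y ∈ ys → R x y → ys ↭ y ∷ rest → y ∉ rest → Bijection R xs rest
  Bijection-remove {x} {y} {xs} {ys} {rest} (x≢xs ∷ _) bij y∈ys Rxy ys↭y∷rest y∉rest = record
    { related    = record { forth = forth′ ; back = back′ }
    ; functional = λ x′∈ y₁∈ y₂∈ → functional (there x′∈) (⊂ys y₁∈) (⊂ys y₂∈)
    ; injective  = λ x₁∈ x₂∈ y′∈ → injective (there x₁∈) (there x₂∈) (⊂ys y′∈)
    }
    where
    open Bijection bij
    ⊂ys : ∀ {v} → v ∈ rest → v ∈ ys
    ⊂ys v∈ = ↭.∈-resp-↭ (↭.↭-sym ys↭y∷rest) (there v∈)
    forth′ : ∀ {x′} → x′ ∈ xs → ∃ λ y′ → y′ ∈ rest × R x′ y′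
    forth′ x′∈ with y′ , y′∈ , Rx′y′ ← forth (there x′∈) with ↭.∈-resp-↭ ys↭y∷rest y′∈
    ... | there y′∈rest = y′ , y′∈rest , Rx′y′
    ... | here refl     =
      ⊥-elim (All¬⇒¬Any x≢xs (subst (_∈ xs) (injective (there x′∈) (here refl) y∈ys Rx′y′ Rxy) x′∈))
    back′ : ∀ {y′} → y′ ∈ rest → ∃ λ x′ → x′ ∈ xs × R x′ y′
    back′ y′∈ with back (⊂ys y′∈)
    ... | x′ , there x′∈ , Rx′y′ = x′ , x′∈ , Rx′y′
    ... | _  , here refl , Rxy′  =
      ⊥-elim (y∉rest (subst (_∈ rest) (functional (here refl) (⊂ys y′∈) y∈ys Rxy′ Rxy) y′∈))

  sum-Bijection : (f : A → ℤ) (g : B → ℤ) {xs : List A} {ys : List B} → Unique xs → Unique ys →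
                  Bijection R xs ys → (∀ {x y} → x ∈ xs → y ∈ ys → R x y → f x ≡ g y) →
                  sumℤ (map f xs) ≡ sumℤ (map g ys)
  sum-Bijection f g {[]} {[]}    _ _ _   _ = refl
  sum-Bijection f g {[]} {_ ∷ _} _ _ bij _ with () ← proj₁ (proj₂ (Bijection.back bij (here refl)))
  sum-Bijection f g {x ∷ xs} {ys} uxs@(_ ∷ uxs′) uys bij f≡g
    with y , y∈ys , Rxy ← Bijection.forth bij (here refl)
    with rest , ys↭y∷rest ← ∈⇒↭∷ y∈ys
    with y∉rest , urest ← Unique-↭∷ uys ys↭y∷rest = begin
      f x + sumℤ (map f xs)
        ≡⟨ cong₂ _+_ (f≡g (here refl) y∈ys Rxy) (sum-Bijection f g uxs′ urest bij′ f≡g′) ⟩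
      g y + sumℤ (map g rest)
        ≡⟨ ↭ₛ.foldr-commMonoid (setoid ℤ) ℤ.+-0-isCommutativeMonoid (↭⇒↭ₛ (↭.map⁺ g (↭.↭-sym ys↭y∷rest))) ⟩
      sumℤ (map g ys) ∎
    where
    open ≡-Reasoning
    bij′ = Bijection-remove uxs bij y∈ys Rxy ys↭y∷rest y∉rest
    f≡g′ : ∀ {x′ y′} → x′ ∈ xs → y′ ∈ rest → R x′ y′ → f x′ ≡ g y′
    f≡g′ x′∈ y′∈ = f≡g (there x′∈) (↭.∈-resp-↭ (↭.↭-sym ys↭y∷rest) (there y′∈))

module _ {A B : Set} {R : A → B → Set} where

  Pointwise⇒Related : ∀ {xs ys} → Pointwise R xs ys → Related R xs ys
  Pointwise⇒Related [] = record { forth = λ () ; back = λ () }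
  Pointwise⇒Related (Rxy ∷ Rxsys) = record
    { forth = λ { (here refl) → _ , here refl , Rxy
                ; (there x∈) → let y , y∈ , R′ = forth x∈ in y , there y∈ , R′ }
    ; back  = λ { (here refl) → _ , here refl , Rxy
                ; (there y∈) → let x , x∈ , R′ = back y∈ in x , there x∈ , R′ }
    }
    where open Related (Pointwise⇒Related Rxsys)

  Pointwise-⊑ʳ : ∀ {xs ys ys′} → ys′ ⊑ ys → Pointwise R xs ys → ∃ λ xs′ → xs′ ⊑ xs × Pointwise R xs′ ys′
  Pointwise-⊑ʳ []             []            = [] , [] , []
  Pointwise-⊑ʳ (_ ∷ʳ ys′⊑)   (_ ∷ Rxsys)   =
    let xs′ , xs′⊑ , R′ = Pointwise-⊑ʳ ys′⊑ Rxsys in xs′ , _ ∷ʳ xs′⊑ , R′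
  Pointwise-⊑ʳ (refl ∷ ys′⊑) (Rxy ∷ Rxsys) =
    let xs′ , xs′⊑ , R′ = Pointwise-⊑ʳ ys′⊑ Rxsys in _ ∷ xs′ , refl ∷ xs′⊑ , Rxy ∷ R′

  Related-resp-↭ʳ : ∀ {xs ys zs} → ys ↭ zs → Related R xs ys → Related R xs zs
  Related-resp-↭ʳ ys↭zs rel = record
    { forth = λ x∈ → let y , y∈ , Rxy = forth x∈ in y , ↭.∈-resp-↭ ys↭zs y∈ , Rxy
    ; back  = λ y∈ → back (↭.∈-resp-↭ (↭.↭-sym ys↭zs) y∈)
    }
    where open Related rel

  Pointwise→Allʳ : ∀ {P : B → Set} {xs ys} → (∀ {x y} → R x y → P y) → Pointwise R xs ys → All P ys
  Pointwise→Allʳ R⇒P []            = []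
  Pointwise→Allʳ R⇒P (Rxy ∷ Rxsys) = R⇒P Rxy ∷ Pointwise→Allʳ R⇒P Rxsys

  choose : ∀ {xs} → All (λ x → ∃ (R x)) xs → ∃ (Pointwise R xs)
  choose []               = [] , []
  choose ((y , Rxy) ∷ ∃R) = let ys , Rxsys = choose ∃R in y ∷ ys , Rxy ∷ Rxsys

module _ {A B : Set} where

  Pointwise⇒pairs : {R : A → B → Set} {xs : List A} {ys : List B} → Pointwise R xs ys →
                    ∃ λ P → map proj₁ P ≡ xs × map proj₂ P ≡ ys × All (λ (x , y) → R x y) P
  Pointwise⇒pairs []       = [] , refl , refl , []
  Pointwise⇒pairs (r ∷ rs) =
    let P , ≡xs , ≡ys , R-P = Pointwise⇒pairs rs
    in (_ , _) ∷ P , cong (_ ∷_) ≡xs , cong (_ ∷_) ≡ys , r ∷ R-P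

  pair-up : {C : Set} (f : A → C) (g : B → C) {xs : List A} {ys : List B} → map f xs ↭ map g ys →
            ∃ λ P → map proj₁ P ↭ xs × map proj₂ P ≡ ys × All (λ (x , y) → f x ≡ g y) P
  pair-up f g fxs↭gys with xs′ , gys≡fxs′ , xs↭xs′ ← ↭.↭-map-inv f fxs↭gys =
    let P , ≡xs′ , ≡ys , f≡g = Pointwise⇒pairs (Pointwise.map⁻ f g (≡⇒Pointwise-≡ (sym gys≡fxs′)))
    in P , subst (_↭ _) (sym ≡xs′) (↭.↭-sym xs↭xs′) , ≡ys , f≡g

-- Admissible families and the elements of L_{n,d}

∈-subfamilies⁺ : {A : Set} {xs ys : List A} → xs ⊑ ys → xs ∈ subfamilies ys
∈-subfamilies⁺ []                        = here refl
∈-subfamilies⁺ {ys = y ∷ ys} (_ ∷ʳ xs⊑ys) = ∈-++⁺ˡ (∈-subfamilies⁺ xs⊑ys)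
∈-subfamilies⁺ {ys = y ∷ ys} (refl ∷ xs⊑ys) =
  ∈-++⁺ʳ (subfamilies ys) (∈-map⁺ (y ∷_) (∈-subfamilies⁺ xs⊑ys))

∈-subfamilies⁻ : {A : Set} {xs : List A} (ys : List A) → xs ∈ subfamilies ys → xs ⊑ ys
∈-subfamilies⁻ []       (here refl) = []
∈-subfamilies⁻ (y ∷ ys) xs∈ with ∈-++⁻ (subfamilies ys) xs∈
... | inj₁ xs∈′ = y ∷ʳ ∈-subfamilies⁻ ys xs∈′
... | inj₂ xs∈′ with _ , xs′∈ , refl ← ∈-map⁻ (y ∷_) xs∈′ = refl ∷ ∈-subfamilies⁻ ys xs′∈

Unique-subfamilies : {A : Set} {xs : List A} → Unique xs → Unique (subfamilies xs)
Unique-subfamilies [] = [] ∷ []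
Unique-subfamilies {xs = x ∷ xs} (x∉xs ∷ u) =
  Unique.++⁺ (Unique-subfamilies u) (Unique.map⁺ ∷-injectiveʳ (Unique-subfamilies u)) disjoint
  where
  disjoint : ∀ {zs} → ¬ (zs ∈ subfamilies xs × zs ∈ map (x ∷_) (subfamilies xs))
  disjoint (zs∈ , zs∈′) with _ , _ , refl ← ∈-map⁻ (x ∷_) zs∈′ =
    All¬⇒¬Any x∉xs (Sublist.lookup (∈-subfamilies⁻ xs zs∈) (here refl))

∈-allSubsets : (X : Subset n) → X ∈ allSubsets n
∈-allSubsets []          = here refl
∈-allSubsets (false ∷ X) = ∈-++⁺ˡ (∈-map⁺ (outside ∷_) (∈-allSubsets X))
∈-allSubsets (true  ∷ X) = ∈-++⁺ʳ (map (outside ∷_) (allSubsets _)) (∈-map⁺ (inside ∷_) (∈-allSubsets X))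

Unique-allSubsets : ∀ n → Unique (allSubsets n)
Unique-allSubsets zero    = [] ∷ []
Unique-allSubsets (suc n) =
  Unique.++⁺ (Unique.map⁺ Vec.∷-injectiveʳ (Unique-allSubsets n))
             (Unique.map⁺ Vec.∷-injectiveʳ (Unique-allSubsets n)) disjoint
  where
  disjoint : ∀ {X} → ¬ (X ∈ map (outside ∷_) (allSubsets n) × X ∈ map (inside ∷_) (allSubsets n))
  disjoint (X∈₁ , X∈₂) with _ , _ , refl ← ∈-map⁻ (outside ∷_) X∈₁ with _ , _ , () ← ∈-map⁻ (inside ∷_) X∈₂

∈-elemsL⁺ : ∀ {n d U} → U ⊑ allSubsets n → InL n d U → U ∈ elemsL n d
∈-elemsL⁺ {n} {d} U⊑ inL = ∈-filter⁺ (inL? n d) (∈-subfamilies⁺ U⊑) inL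

∈-elemsL⁻ : ∀ {n d U} → U ∈ elemsL n d → U ⊑ allSubsets n × InL n d U
∈-elemsL⁻ {n} {d} U∈ =
  let U∈′ , inL = ∈-filter⁻ (inL? n d) {xs = subfamilies (allSubsets n)} U∈
  in ∈-subfamilies⁻ (allSubsets n) U∈′ , inL

Unique-elemsL : ∀ n d → Unique (elemsL n d)
Unique-elemsL n d = Unique.filter⁺ (inL? n d) (Unique-subfamilies (Unique-allSubsets n))

record Admissible (n d : ℕ) (T : List (Subset n)) : Set where
  field
    unique   : Unique T
    bounded  : All (λ X → ∣ X ∣ ℕ.≤ d) T
    positive : ∀ {B} → B ⊑ T → 2 ℕ.≤ length B → 0ℤ ℤ.< D d B

InL⇒Admissible : ∀ {n d T} → InL n d T → Admissible n d T
InL⇒Admissible (u , b , p) = record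
  { unique = u ; bounded = b ; positive = λ B⊑T → All.lookup p (∈-subfamilies⁺ B⊑T) }

Admissible⇒InL : ∀ {n d T} → Admissible n d T → InL n d T
Admissible⇒InL {T = T} a =
  unique , bounded , All.tabulate (λ B∈ → positive (∈-subfamilies⁻ T B∈))
  where open Admissible a

Admissible-resp-↭ : ∀ {n d} {T T′ : List (Subset n)} → T ↭ T′ → Admissible n d T → Admissible n d T′
Admissible-resp-↭ {d = d} T↭T′ a = record
  { unique   = ↭ₛ.Unique-resp-↭ (setoid _) (↭⇒↭ₛ T↭T′) unique
  ; bounded  = ↭.All-resp-↭ T↭T′ bounded
  ; positive = positive′
  }
  where
  open Admissible a
  positive′ : ∀ {B} → B ⊑ _ → 2 ℕ.≤ length B → 0ℤ ℤ.< D d B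
  positive′ B⊑T′ 2≤|B| with B′ , B′⊑T , B↭B′ ← ⊑-resp-↭ B⊑T′ (↭.↭-sym T↭T′) =
    subst (0ℤ ℤ.<_) (D-↭ d (↭.↭-sym B↭B′)) (positive B′⊑T (subst (2 ℕ.≤_) (↭.↭-length B↭B′) 2≤|B|))

module _ {n d : ℕ} {T : List (Subset n)} (a : Admissible n d T) where
  open Admissible a

  nonneg : ∀ {B} → B ⊑ T → 1 ℕ.≤ length B → 0ℤ ℤ.≤ D d B
  nonneg {X ∷ []}    _    _ = ℤ.≤-reflexive (sym D-[ X ])
  nonneg {_ ∷ _ ∷ _} B⊑T _ = ℤ.<⇒≤ (positive B⊑T (ℕ.s≤s (ℕ.s≤s ℕ.z≤n)))

  below-unique : ∀ {X Y Z} → X ∈ T → Y ∈ T → X ⊆ Z → Y ⊆ Z → ∣ Z ∣ ℕ.≤ d → X ≡ Y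
  below-unique {X} {Y} {Z} X∈T Y∈T X⊆Z Y⊆Z |Z|≤d with Vec.≡-dec Bool._≟_ X Y
  ... | yes X≡Y = X≡Y
  ... | no X≢Y  = ⊥-elim (⊎.[ spread X⊆Z Y⊆Z , spread Y⊆Z X⊆Z ] (pair-⊑ X∈T Y∈T X≢Y))
    where
    spread : ∀ {U V} → U ⊆ Z → V ⊆ Z → U ∷ V ∷ [] ⊑ T → ⊥
    spread {U} {V} U⊆Z V⊆Z UV⊑T = ℕ.<⇒≱ (D-pair d U V (positive UV⊑T (ℕ.s≤s (ℕ.s≤s ℕ.z≤n))))
      (ℕ.≤-trans (p⊆q⇒∣p∣≤∣q∣ (∪-lub U⊆Z V⊆Z)) (ℕ.m≤n⇒m≤1+n |Z|≤d))

-- Grouping B by the pieces below its members: the groups have non-negative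
-- defect, and by D-∷≤D-++ the defect of B dominates that of the pieces used.
D-pieces≤ : ∀ d (Ps B : List (Subset n)) → Refines Ps B → 1 ℕ.≤ length B →
            (∀ {q G} → q ∈ Ps → G ⊑ B → All (q ⊆_) G → 1 ℕ.≤ length G → 0ℤ ℤ.≤ D d G) →
            ∃ λ J → J ⊑ Ps × Refines J B × D d J ℤ.≤ D d B
D-pieces≤ d [] (_ ∷ _) (() ∷ _) _ _
D-pieces≤ d (p ∷ Ps) B Ps≼B 1≤|B| groups≥0 =
  split (filter (p ⊆?_) B) (filter (∁? (p ⊆?_)) B) (filter-partition-↭ (p ⊆?_) B)
        (all-filter (p ⊆?_) B) Ps≼R
        (groups≥0 (here refl) (filter-⊑ (p ⊆?_) B) (all-filter (p ⊆?_) B))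
        (λ q∈Ps G⊑R → groups≥0 (there q∈Ps) (Sublist.⊆-trans G⊑R (filter-⊑ (∁? (p ⊆?_)) B)))
  where
  Ps≼R : Refines Ps (filter (∁? (p ⊆?_)) B)
  Ps≼R = All.zipWith (λ (p⊈Y , Y≽p∷Ps) → Any.tail p⊈Y Y≽p∷Ps)
           (all-filter (∁? (p ⊆?_)) B , All.filter⁺ (∁? (p ⊆?_)) Ps≼B)

  Result = ∃ λ J → J ⊑ p ∷ Ps × Refines J B × D d J ℤ.≤ D d B

  split : ∀ G R → B ↭ G ++ R → All (p ⊆_) G → Refines Ps R → (1 ℕ.≤ length G → 0ℤ ℤ.≤ D d G) →
          (∀ {q G′} → q ∈ Ps → G′ ⊑ R → All (q ⊆_) G′ → 1 ℕ.≤ length G′ → 0ℤ ℤ.≤ D d G′) → Result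
  split [] [] B↭[] _ _ _ _ with () ← subst (1 ℕ.≤_) (↭.↭-length B↭[]) 1≤|B|
  split [] R@(_ ∷ _) B↭R _ Ps≼R _ groups≥0 =
    let J , J⊑Ps , J≼R , DJ≤DR = D-pieces≤ d Ps R Ps≼R (ℕ.s≤s ℕ.z≤n) groups≥0
    in J , p ∷ʳ J⊑Ps , ↭.All-resp-↭ (↭.↭-sym B↭R) J≼R ,
       ℤ.≤-trans DJ≤DR (ℤ.≤-reflexive (D-↭ d (↭.↭-sym B↭R)))
  split G@(_ ∷ _) [] B↭G p⊆G _ DG≥0 _ =
    [ p ] , refl ∷ Sublist.minimum Ps ,
    ↭.All-resp-↭ (↭.↭-sym B↭G′) (All.map here p⊆G) ,
    ℤ.≤-trans (ℤ.≤-reflexive D-[ p ])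
              (ℤ.≤-trans (DG≥0 (ℕ.s≤s ℕ.z≤n)) (ℤ.≤-reflexive (D-↭ d (↭.↭-sym B↭G′))))
    where B↭G′ = subst (B ↭_) (++-identityʳ G) B↭G
  split G@(_ ∷ _) R@(_ ∷ _) B↭G++R p⊆G Ps≼R DG≥0 groups≥0 =
    let J , J⊑Ps , J≼R , DJ≤DR = D-pieces≤ d Ps R Ps≼R (ℕ.s≤s ℕ.z≤n) groups≥0
    in p ∷ J , refl ∷ J⊑Ps ,
       ↭.All-resp-↭ (↭.↭-sym B↭G++R) (All.++⁺ (All.map here p⊆G) (All.map there J≼R)) ,
       ℤ.≤-trans (D-∷≤D-++ d {J = J} {G} {R} p⊆G (⋂-refines J≼R) (DG≥0 (ℕ.s≤s ℕ.z≤n)) DJ≤DR)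
                 (ℤ.≤-reflexive (D-↭ d (↭.↭-sym B↭G++R)))

-- Matchings and the correspondence of upper sets

-- Paired members have the same codimension and complements of the same size,
-- which is what lets the sets above p correspond to the sets above p′ (Corr).
record Matching (n d n′ d′ : ℕ) : Set₁ where
  field
    Paired      : Subset n → Subset n′ → Set
    pieces      : List (Subset n)
    pieces′     : List (Subset n′)
    admissible  : Admissible n d pieces
    admissible′ : Admissible n′ d′ pieces′
    ∈-pieces    : ∀ {p p′} → Paired p p′ → p ∈ pieces
    ∈-pieces′   : ∀ {p p′} → Paired p p′ → p′ ∈ pieces′
    partner     : ∀ {p} → p ∈ pieces → ∃ (Paired p)
    partner′    : ∀ {p′} → p′ ∈ pieces′ → ∃ λ p → Paired p p′
    functional  : ∀ {p p′ q′} → Paired p p′ → Paired p q′ → p′ ≡ q′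
    injective   : ∀ {p q p′} → Paired p p′ → Paired q p′ → p ≡ q
    codim≡      : ∀ {p p′} → Paired p p′ → codim d p ≡ codim d′ p′
    holes≡      : ∀ {p p′} → Paired p p′ → ∣ ∁ p ∣ ≡ ∣ ∁ p′ ∣

Matching-swap : ∀ {n d n′ d′} → Matching n d n′ d′ → Matching n′ d′ n d
Matching-swap M = record
  { Paired = λ p′ p → Paired p p′ ; pieces = pieces′ ; pieces′ = pieces
  ; admissible = admissible′ ; admissible′ = admissible
  ; ∈-pieces = ∈-pieces′ ; ∈-pieces′ = ∈-pieces ; partner = partner′ ; partner′ = partner
  ; functional = injective ; injective = functional
  ; codim≡ = λ pp′ → sym (codim≡ pp′) ; holes≡ = λ pp′ → sym (holes≡ pp′)
  }
  where open Matching M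

module Correspondence {n d n′ d′ : ℕ} (M : Matching n d n′ d′) where
  open Matching M
  open import Data.Integer using (_+_)

  private variable
    Y Z : Subset n
    Y′ Y₁′ Y₂′ Z′ : Subset n′
    B : List (Subset n)
    B′ : List (Subset n′)

  -- Y′ arises from Y by replacing the piece p below Y by its partner p′ and
  -- keeping the residue.
  record Corr (Y : Subset n) (Y′ : Subset n′) : Set where
    constructor corr
    field
      {piece}  : Subset n
      {piece′} : Subset n′
      paired   : Paired piece piece′
      below    : piece ⊆ Y
      below′   : piece′ ⊆ Y′
      residue≡ : residue piece Y ≡ residue piece′ Y′
      bounded  : ∣ Y ∣ ℕ.≤ d
      bounded′ : ∣ Y′ ∣ ℕ.≤ d′

  codim-transport : ∀ {X X′} → Paired p p′ → p ⊆ X → p′ ⊆ X′ → residue p X ≡ residue p′ X′ →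
                    codim d X ≡ codim d′ X′
  codim-transport {p} {p′} {X} {X′} pp′ p⊆X p′⊆X′ r≡ = begin
    codim d X                              ≡⟨ codim-above d p⊆X ⟩
    codim d p - + weight (residue p X)     ≡⟨ cong₂ (λ c r → c - + weight r) (codim≡ pp′) r≡ ⟩
    codim d′ p′ - + weight (residue p′ X′) ≡⟨ codim-above d′ p′⊆X′ ⟨
    codim d′ X′                            ∎
    where open ≡-Reasoning

  Corr-codim : Corr Y Y′ → codim d Y ≡ codim d′ Y′
  Corr-codim (corr pp′ p⊆Y p′⊆Y′ r≡ _ _) = codim-transport pp′ p⊆Y p′⊆Y′ r≡

  -- Only one piece lies below a set with at most d points (below-unique).
  Corr-at : Corr Y Y′ → Paired q q′ → q ⊆ Y → q′ ⊆ Y′ × residue q Y ≡ residue q′ Y′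
  Corr-at (corr pp′ p⊆Y p′⊆Y′ r≡ |Y|≤d _) qq′ q⊆Y
    with refl ← below-unique admissible (∈-pieces pp′) (∈-pieces qq′) p⊆Y q⊆Y |Y|≤d
    with refl ← functional pp′ qq′ = p′⊆Y′ , r≡

  Corr-functional : Corr Y Y₁′ → Corr Y Y₂′ → Y₁′ ≡ Y₂′
  Corr-functional c₁ (corr pp′ p⊆Y p′⊆Y₂′ r₂ _ _) =
    let p′⊆Y₁′ , r₁ = Corr-at c₁ pp′ p⊆Y in residue-injective p′⊆Y₁′ p′⊆Y₂′ (trans (sym r₁) r₂)

  Corr-mono : Corr Y Y′ → Corr Z Z′ → Y ⊆ Z → Y′ ⊆ Z′
  Corr-mono (corr {piece = p} pp′ p⊆Y _ rY _ _) cZ Y⊆Z =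
    let p′⊆Z′ , rZ = Corr-at cZ pp′ (⊆-trans p⊆Y Y⊆Z)
    in residue-mono⁻ p′⊆Z′ (subst₂ (Pointwise Bool._≤_) rY rZ (residue-mono {m = p} Y⊆Z))

  Corr-exists : Paired p p′ → p ⊆ Y → ∣ Y ∣ ℕ.≤ d → ∃ (Corr Y)
  Corr-exists {p} {p′} {Y} pp′ p⊆Y |Y|≤d =
    extend p′ bits , corr pp′ p⊆Y (⊆-extend p′ bits) (sym r≡) |Y|≤d |Y′|≤d′
    where
    bits = residue p Y
    r≡ : residue p′ (extend p′ bits) ≡ bits
    r≡ = residue-extend p′ bits (trans (length-residue p Y) (holes≡ pp′))
    |Y′|≤d′ : ∣ extend p′ bits ∣ ℕ.≤ d′
    |Y′|≤d′ = 0<codim⇒bounded d′ (extend p′ bits)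
                (subst (0ℤ ℤ.<_) (codim-transport pp′ p⊆Y (⊆-extend p′ bits) (sym r≡))
                                 (bounded⇒0<codim d Y |Y|≤d))

  Corr-self : Paired p p′ → Corr p p′
  Corr-self {p} {p′} pp′ =
    corr pp′ ⊆-refl ⊆-refl residues≡
         (All.lookup (Admissible.bounded admissible) (∈-pieces pp′))
         (All.lookup (Admissible.bounded admissible′) (∈-pieces′ pp′))
    where
    residues≡ : residue p p ≡ residue p′ p′
    residues≡ = begin
      residue p p                ≡⟨ residue-self p ⟩
      replicate (∣ ∁ p ∣) false  ≡⟨ cong (λ k → replicate k false) (holes≡ pp′) ⟩
      replicate (∣ ∁ p′ ∣) false ≡⟨ residue-self p′ ⟨
      residue p′ p′              ∎
      where open ≡-Reasoning

  ρ-transport : Pointwise Corr B B′ → ρ d B ≡ ρ d′ B′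
  ρ-transport []       = refl
  ρ-transport (c ∷ cs) = cong₂ _+_ (Corr-codim c) (ρ-transport cs)

  above-transport : Paired p p′ → Pointwise Corr B B′ → All (p ⊆_) B → All (p′ ⊆_) B′
  above-transport pp′ []       []            = []
  above-transport pp′ (c ∷ cs) (p⊆Y ∷ p⊆B) = proj₁ (Corr-at c pp′ p⊆Y) ∷ above-transport pp′ cs p⊆B

  ⋂-residue : Paired p p′ → Pointwise Corr B B′ → All (p ⊆_) B → residue p (⋂ B) ≡ residue p′ (⋂ B′)
  ⋂-residue {p} {p′} pp′ [] [] = begin
    residue p ⊤                   ≡⟨ residue-⊤ p ⟩
    replicate (∣ ∁ p ∣) true      ≡⟨ cong (λ k → replicate k true) (holes≡ pp′) ⟩
    replicate (∣ ∁ p′ ∣) true     ≡⟨ residue-⊤ p′ ⟨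
    residue p′ ⊤                  ∎
    where open ≡-Reasoning
  ⋂-residue {p} {p′} pp′ (_∷_ {x = Y} {y = Y′} {xs = B} {ys = B′} c cs) (p⊆Y ∷ p⊆B) = begin
    residue p (Y ∩ ⋂ B)                                  ≡⟨ residue-∩ p Y (⋂ B) ⟩
    zipWith _∧_ (residue p Y) (residue p (⋂ B))          ≡⟨ cong₂ (zipWith _∧_) (proj₂ (Corr-at c pp′ p⊆Y))
                                                                                (⋂-residue pp′ cs p⊆B) ⟩
    zipWith _∧_ (residue p′ Y′) (residue p′ (⋂ B′))      ≡⟨ residue-∩ p′ Y′ (⋂ B′) ⟨
    residue p′ (Y′ ∩ ⋂ B′)                               ∎
    where open ≡-Reasoning

  D-transport : Paired p p′ → Pointwise Corr B B′ → All (p ⊆_) B → D d B ≡ D d′ B′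
  D-transport pp′ cs p⊆B =
    cong₂ _-_ (codim-transport pp′ (⋂-greatest p⊆B) (⋂-greatest (above-transport pp′ cs p⊆B))
                               (⋂-residue pp′ cs p⊆B))
              (ρ-transport cs)

module Families {n d n′ d′ : ℕ} (M : Matching n d n′ d′) where
  open Matching M
  open Correspondence M public
  private module C⁻¹ = Correspondence (Matching-swap M)

  private variable
    Y Y₁ Y₂ : Subset n
    Y′ : Subset n′
    U B : List (Subset n)
    V U′ B′ : List (Subset n′)

  Corr-swap : Corr Y Y′ → C⁻¹.Corr Y′ Y
  Corr-swap (corr pp′ p⊆Y p′⊆Y′ r≡ |Y|≤d |Y′|≤d′) = C⁻¹.corr pp′ p′⊆Y′ p⊆Y (sym r≡) |Y′|≤d′ |Y|≤d

  Corr-unswap : C⁻¹.Corr Y′ Y → Corr Y Y′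
  Corr-unswap (C⁻¹.corr pp′ p′⊆Y′ p⊆Y r≡ |Y′|≤d′ |Y|≤d) = corr pp′ p⊆Y p′⊆Y′ (sym r≡) |Y|≤d |Y′|≤d′

  Corr-injective : Corr Y₁ Y′ → Corr Y₂ Y′ → Y₁ ≡ Y₂
  Corr-injective c₁ c₂ = C⁻¹.Corr-functional (Corr-swap c₁) (Corr-swap c₂)

  Corr-refines′ : Corr Y Y′ → Any (_⊆ Y′) pieces′
  Corr-refines′ (corr pp′ _ p′⊆Y′ _ _ _) = lose (∈-pieces′ pp′) p′⊆Y′

  Unique-transport : Pointwise Corr U V → Unique U → Unique V
  Unique-transport []          []           = []
  Unique-transport (c ∷ cs) (Y≢U ∷ uU) =
    All.¬Any⇒All¬ _ Y′∉V ∷ Unique-transport cs uU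
    where
    Y′∉V : _ ∉ _
    Y′∉V Y′∈V = let _ , Y₁∈U , c₁ = Related.back (Pointwise⇒Related cs) Y′∈V
                in All¬⇒¬Any Y≢U (subst (_∈ _) (Corr-injective c₁ c) Y₁∈U)

  groups-nonneg : Admissible n d U → Pointwise Corr U V → ∀ {q′ G′} → q′ ∈ pieces′ → G′ ⊑ V →
                  All (q′ ⊆_) G′ → 1 ℕ.≤ length G′ → 0ℤ ℤ.≤ D d′ G′
  groups-nonneg admU cs q′∈ G′⊑V q′⊆G′ 1≤|G′|
    with q , qq′ ← partner′ q′∈
    with G , G⊑U , cs′ ← Pointwise-⊑ʳ G′⊑V cs =
    subst (0ℤ ℤ.≤_) (D-transport qq′ cs′ q⊆G)
          (nonneg admU G⊑U (subst (1 ℕ.≤_) (sym (Pointwise-length cs′)) 1≤|G′|))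
    where
    q⊆G = C⁻¹.above-transport qq′ (symmetric Corr-swap cs′) q′⊆G′

  positive-transport : Admissible n d U → Pointwise Corr U V →
                       ∀ {B′} → B′ ⊑ V → 2 ℕ.≤ length B′ → 0ℤ ℤ.< D d′ B′
  positive-transport admU cs {B′} B′⊑V 2≤|B′|
    with B , B⊑U , csB ← Pointwise-⊑ʳ B′⊑V cs
    with D-pieces≤ d′ pieces′ B′ (Pointwise→Allʳ Corr-refines′ csB) (ℕ.≤-trans (ℕ.s≤s ℕ.z≤n) 2≤|B′|)
                   (λ q′∈ G′⊑B′ → groups-nonneg admU cs q′∈ (Sublist.⊆-trans G′⊑B′ B′⊑V))
  ... | [] , _ , J≼B′ , _ with () ∷ _ ← J≼B′
  ... | q′ ∷ [] , J⊑ , J≼B′ , _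
    with q , qq′ ← partner′ (Sublist.lookup J⊑ (here refl)) =
    subst (0ℤ ℤ.<_) (D-transport qq′ csB q⊆B)
          (Admissible.positive admU B⊑U (subst (2 ℕ.≤_) (sym (Pointwise-length csB)) 2≤|B′|))
    where
    q⊆B = C⁻¹.above-transport qq′ (symmetric Corr-swap csB) (Refines-singleton⇒above J≼B′)
  ... | J@(_ ∷ _ ∷ _) , J⊑ , _ , DJ≤DB′ =
    ℤ.<-≤-trans (Admissible.positive admissible′ J⊑ (ℕ.s≤s (ℕ.s≤s ℕ.z≤n))) DJ≤DB′

  Admissible-transport : Admissible n d U → Pointwise Corr U V → Admissible n′ d′ V
  Admissible-transport admU cs = record
    { unique   = Unique-transport cs (Admissible.unique admU)
    ; bounded  = Pointwise→Allʳ Corr.bounded′ cs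
    ; positive = positive-transport admU cs
    }

  record FamCorr (U : List (Subset n)) (U′ : List (Subset n′)) : Set where
    field
      unique  : Unique U
      unique′ : Unique U′
      related : Related Corr U U′
    open Related related public

  FamCorr-pieces : FamCorr pieces pieces′
  FamCorr-pieces = record
    { unique  = Admissible.unique admissible
    ; unique′ = Admissible.unique admissible′
    ; related = record
      { forth = λ p∈ → let p′ , pp′ = partner p∈ in p′ , ∈-pieces′ pp′ , Corr-self pp′
      ; back  = λ p′∈ → let p , pp′ = partner′ p′∈ in p , ∈-pieces pp′ , Corr-self pp′
      }
    }

  FamCorr-ρ : FamCorr U U′ → ρ d U ≡ ρ d′ U′
  FamCorr-ρ rel = sum-Bijection (codim d) (codim d′) unique unique′ bijection (λ _ _ → Corr-codim)
    where
    open FamCorr rel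
    bijection = record
      { related    = related
      ; functional = λ _ _ _ → Corr-functional
      ; injective  = λ _ _ _ → Corr-injective
      }

  FamCorr-< : ∀ {S S′} → FamCorr U U′ → FamCorr S S′ → U <[ d ] S → U′ <[ d′ ] S′
  FamCorr-< {U′ = U′} {S′ = S′} relU relS (ρU<ρS , S≼U) =
    subst₂ ℤ._<_ (FamCorr-ρ relU) (FamCorr-ρ relS) ρU<ρS , All.tabulate below
    where
    below : ∀ {Y′} → Y′ ∈ U′ → Any (_⊆ Y′) S′
    below Y′∈U′
      with Y , Y∈U , cY ← FamCorr.back relU Y′∈U′
      with Z , Z∈S , Z⊆Y ← find (All.lookup S≼U Y∈U)
      with Z′ , Z′∈S′ , cZ ← FamCorr.forth relS Z∈S = lose Z′∈S′ (Corr-mono cZ cY Z⊆Y)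

  FamCorr-refines′ : ∀ {S S′} → FamCorr S S′ → Refines pieces′ S′
  FamCorr-refines′ rel = All.tabulate (λ Y′∈ → Corr-refines′ (proj₂ (proj₂ (FamCorr.back rel Y′∈))))

  Corr-choose : Refines pieces U → All (λ Y → ∣ Y ∣ ℕ.≤ d) U → ∃ (Pointwise Corr U)
  Corr-choose pieces≼U bounded = choose (All.zipWith corr-of (pieces≼U , bounded))
    where
    corr-of : ∀ {Y} → Any (_⊆ Y) pieces × ∣ Y ∣ ℕ.≤ d → ∃ (Corr Y)
    corr-of (p≼Y , |Y|≤d) with p , p∈ , p⊆Y ← find p≼Y with p′ , pp′ ← partner p∈ =
      Corr-exists pp′ p⊆Y |Y|≤d

  FamCorr-exists : Admissible n d U → Refines pieces U → ∃ λ U′ → U′ ∈ elemsL n′ d′ × FamCorr U U′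
  FamCorr-exists admU pieces≼U
    with V , cs ← Corr-choose pieces≼U (Admissible.bounded admU)
    with U′ , U′⊑ , U′↭V ← ⊑-representative (Vec.≡-dec Bool._≟_) (Unique-allSubsets n′)
                              (Admissible.unique (Admissible-transport admU cs)) (λ {v} _ → ∈-allSubsets v) =
    U′ , ∈-elemsL⁺ U′⊑ (Admissible⇒InL admU′) ,
    record { unique = Admissible.unique admU ; unique′ = Admissible.unique admU′
           ; related = Related-resp-↭ʳ (↭.↭-sym U′↭V) (Pointwise⇒Related cs) }
    where admU′ = Admissible-resp-↭ (↭.↭-sym U′↭V) (Admissible-transport admU cs)

  FamCorr-functional : ∀ {U₁′ U₂′} → FamCorr U U₁′ → FamCorr U U₂′ →
                       U₁′ ⊑ allSubsets n′ → U₂′ ⊑ allSubsets n′ → U₁′ ≡ U₂′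
  FamCorr-functional rel₁ rel₂ U₁′⊑ U₂′⊑ =
    ⊑-same-∈⇒≡ (Unique-allSubsets n′) U₁′⊑ U₂′⊑ (transfer rel₁ rel₂) (transfer rel₂ rel₁)
    where
    transfer : ∀ {U₁′ U₂′} → FamCorr U U₁′ → FamCorr U U₂′ → ∀ {Y′} → Y′ ∈ U₁′ → Y′ ∈ U₂′
    transfer rel₁ rel₂ Y′∈
      with Y , Y∈ , c₁ ← FamCorr.back rel₁ Y′∈
      with Y₂′ , Y₂′∈ , c₂ ← FamCorr.forth rel₂ Y∈ = subst (_∈ _) (Corr-functional c₂ c₁) Y₂′∈

-- The Möbius function

<[]-trans : ∀ {d} {U V S : List (Subset n)} → U <[ d ] V → V <[ d ] S → U <[ d ] S
<[]-trans U<V@(ρU<ρV , _) (ρV<ρS , S≼V) = ℤ.<-trans ρU<ρV ρV<ρS , Refines-< U<V S≼V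

<[]-irrefl : ∀ {d} {U : List (Subset n)} → ¬ U <[ d ] U
<[]-irrefl (ρU<ρU , _) = ℤ.<-irrefl refl ρU<ρU

Below : (n d : ℕ) → List (Subset n) → List (List (Subset n))
Below n d S = filter (λ U → <? d U S) (elemsL n d)

∈-Below⁻ : ∀ {n d} {U S : List (Subset n)} → U ∈ Below n d S → U ∈ elemsL n d × U <[ d ] S
∈-Below⁻ {n} {d} {S = S} = ∈-filter⁻ (λ U → <? d U S) {xs = elemsL n d}

∈-Below⁺ : ∀ {n d} {U S : List (Subset n)} → U ∈ elemsL n d → U <[ d ] S → U ∈ Below n d S
∈-Below⁺ {d = d} {S = S} = ∈-filter⁺ (λ U → <? d U S)

∈-Below⇒⊑ : ∀ {n d} {U S : List (Subset n)} → U ∈ Below n d S → U ⊑ allSubsets n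
∈-Below⇒⊑ U∈ = proj₁ (∈-elemsL⁻ (proj₁ (∈-Below⁻ U∈)))

Admissible-Below : ∀ {n d} {U S : List (Subset n)} → U ∈ Below n d S → Admissible n d U
Admissible-Below U∈ = InL⇒Admissible (proj₂ (∈-elemsL⁻ (proj₁ (∈-Below⁻ U∈))))

#below : (n d : ℕ) → List (Subset n) → ℕ
#below n d S = length (Below n d S)

#below-< : ∀ {n d} {U S : List (Subset n)} → U ∈ elemsL n d → U <[ d ] S → #below n d U ℕ.< #below n d S
#below-< {d = d} {U} {S} U∈ U<S =
  length-filter-< (λ V → <? d V U) (λ V → <? d V S) (λ V<U → <[]-trans V<U U<S) U∈ U<S <[]-irrefl

#below-bound : ∀ n d (S : List (Subset n)) → #below n d S ℕ.< suc (length (elemsL n d))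
#below-bound n d S = ℕ.s≤s (length-filter (λ U → <? d U S) (elemsL n d))

mobiusF-fuel : ∀ {n} d f g (S : List (Subset n)) → #below n d S ℕ.< f → #below n d S ℕ.< g →
               mobiusF n d f S ≡ mobiusF n d g S
mobiusF-fuel d (suc f) (suc g) []      _ _ = refl
mobiusF-fuel {n} d (suc f) (suc g) S@(_ ∷ _) (ℕ.s≤s b<f) (ℕ.s≤s b<g) =
  cong (λ xs → - sumℤ xs) (map-cong-local (All.tabulate same))
  where
  same : ∀ {U} → U ∈ Below n d S → mobiusF n d f U ≡ mobiusF n d g U
  same U∈ with U∈L , U<S ← ∈-Below⁻ U∈ =
    mobiusF-fuel d f g _ (ℕ.<-≤-trans (#below-< U∈L U<S) b<f) (ℕ.<-≤-trans (#below-< U∈L U<S) b<g)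

module MöbiusTransport {n d n′ d′ : ℕ} (M : Matching n d n′ d′) where
  open Matching M using (pieces)
  module F = Families M
  module F⁻¹ = Families (Matching-swap M)

  private variable
    S U : List (Subset n)
    S′ U′ : List (Subset n′)

  FamCorr-swap : F.FamCorr U U′ → F⁻¹.FamCorr U′ U
  FamCorr-swap rel =
    record { unique = unique′ ; unique′ = unique ; related = Related-swap F.Corr-swap related }
    where open F.FamCorr rel

  FamCorr-unswap : F⁻¹.FamCorr U′ U → F.FamCorr U U′
  FamCorr-unswap rel =
    record { unique = unique′ ; unique′ = unique ; related = Related-swap F.Corr-unswap related }
    where open F⁻¹.FamCorr rel

  Below-Bijection : F.FamCorr S S′ → Refines pieces S → Bijection F.FamCorr (Below n d S) (Below n′ d′ S′)
  Below-Bijection {S} {S′} relS pieces≼S = record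
    { related    = record { forth = forth ; back = back }
    ; functional = λ _ U₁′∈ U₂′∈ r₁ r₂ → F.FamCorr-functional r₁ r₂ (∈-Below⇒⊑ U₁′∈) (∈-Below⇒⊑ U₂′∈)
    ; injective  = λ U₁∈ U₂∈ _ r₁ r₂ →
                     F⁻¹.FamCorr-functional (FamCorr-swap r₁) (FamCorr-swap r₂)
                                            (∈-Below⇒⊑ U₁∈) (∈-Below⇒⊑ U₂∈)
    }
    where
    forth : ∀ {U} → U ∈ Below n d S → ∃ λ U′ → U′ ∈ Below n′ d′ S′ × F.FamCorr U U′
    forth U∈ =
      let U∈L , U<S = ∈-Below⁻ U∈
          U′ , U′∈L , relU = F.FamCorr-exists (Admissible-Below U∈) (Refines-< U<S pieces≼S)
      in U′ , ∈-Below⁺ U′∈L (F.FamCorr-< relU relS U<S) , relU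
    back : ∀ {U′} → U′ ∈ Below n′ d′ S′ → ∃ λ U → U ∈ Below n d S × F.FamCorr U U′
    back U′∈ =
      let U′∈L , U′<S′ = ∈-Below⁻ U′∈
          U , U∈L , relU = F⁻¹.FamCorr-exists (Admissible-Below U′∈)
                                              (Refines-< U′<S′ (F.FamCorr-refines′ relS))
      in U , ∈-Below⁺ U∈L (F⁻¹.FamCorr-< relU (FamCorr-swap relS) U′<S′) , FamCorr-unswap relU

  mobiusF-transport : ∀ f S S′ → F.FamCorr S S′ → Refines pieces S → #below n d S ℕ.< f →
                      mobiusF n d f S ≡ mobiusF n′ d′ (suc (#below n′ d′ S′)) S′
  mobiusF-transport (suc f) []        []        _    _ _ = refl
  mobiusF-transport (suc f) []        (_ ∷ _)   relS _ _
    with () ← proj₁ (proj₂ (F.FamCorr.back relS (here refl)))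
  mobiusF-transport (suc f) (_ ∷ _)   []        relS _ _
    with () ← proj₁ (proj₂ (F.FamCorr.forth relS (here refl)))
  mobiusF-transport (suc f) S@(_ ∷ _) S′@(_ ∷ _) relS pieces≼S (ℕ.s≤s #S<f) =
    cong -_ (sum-Bijection (mobiusF n d f) (mobiusF n′ d′ (#below n′ d′ S′))
               (Unique.filter⁺ _ (Unique-elemsL n d)) (Unique.filter⁺ _ (Unique-elemsL n′ d′))
               (Below-Bijection relS pieces≼S) same)
    where
    same : ∀ {U U′} → U ∈ Below n d S → U′ ∈ Below n′ d′ S′ → F.FamCorr U U′ →
           mobiusF n d f U ≡ mobiusF n′ d′ (#below n′ d′ S′) U′
    same {U} {U′} U∈ U′∈ relU
      with U∈L , U<S ← ∈-Below⁻ U∈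
      with U′∈L , U′<S′ ← ∈-Below⁻ U′∈ =
      trans (mobiusF-transport f U U′ relU (Refines-< U<S pieces≼S) (ℕ.<-≤-trans (#below-< U∈L U<S) #S<f))
            (mobiusF-fuel d′ _ _ U′ ℕ.≤-refl (#below-< U′∈L U′<S′))

  μ-transport : ∀ {T T′} → F.FamCorr T T′ → Refines pieces T → μ n d T ≡ μ n′ d′ T′
  μ-transport {T} {T′} relT pieces≼T =
    trans (mobiusF-transport _ T T′ relT pieces≼T (#below-bound n d T))
          (mobiusF-fuel d′ _ _ T′ ℕ.≤-refl (#below-bound n′ d′ T′))

-- Families of the same type

open import Data.Nat using (_+_; _≤_)

Matching-from-pairs : ∀ {n d n′ d′} {T : List (Subset n)} {T′ : List (Subset n′)} →
  InL n d T → InL n′ d′ T′ → (P : List (Subset n × Subset n′)) → map proj₁ P ↭ T → map proj₂ P ≡ T′ →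
  All (λ (p , p′) → codim d p ≡ codim d′ p′ × ∣ ∁ p ∣ ≡ ∣ ∁ p′ ∣) P → Matching n d n′ d′
Matching-from-pairs {T = T} {T′} inL inL′ P P↭T P≡T′ matched = record
  { Paired      = λ p p′ → (p , p′) ∈ P
  ; pieces      = T
  ; pieces′     = T′
  ; admissible  = InL⇒Admissible inL
  ; admissible′ = InL⇒Admissible inL′
  ; ∈-pieces    = λ pp′∈P → ↭.∈-resp-↭ P↭T (∈-map⁺ proj₁ pp′∈P)
  ; ∈-pieces′   = λ pp′∈P → subst (_ ∈_) P≡T′ (∈-map⁺ proj₂ pp′∈P)
  ; partner     = λ p∈T → let a , a∈P , p≡ = ∈-map⁻ proj₁ (↭.∈-resp-↭ (↭.↭-sym P↭T) p∈T)
                          in proj₂ a , subst (λ q → (q , proj₂ a) ∈ P) (sym p≡) a∈P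
  ; partner′    = λ p′∈T′ → let a , a∈P , p′≡ = ∈-map⁻ proj₂ (subst (_ ∈_) (sym P≡T′) p′∈T′)
                            in proj₁ a , subst (λ q → (proj₁ a , q) ∈ P) (sym p′≡) a∈P
  ; functional  = λ a∈P b∈P → ,-injectiveʳ (Unique-map-injective {f = proj₁} unique₁ a∈P b∈P refl)
  ; injective   = λ a∈P b∈P → ,-injectiveˡ (Unique-map-injective {f = proj₂} unique₂ a∈P b∈P refl)
  ; codim≡      = λ a∈P → proj₁ (All.lookup matched a∈P)
  ; holes≡      = λ a∈P → proj₂ (All.lookup matched a∈P)
  }
  where
  unique₁ : Unique (map proj₁ P)
  unique₁ = ↭ₛ.Unique-resp-↭ (setoid _) (↭⇒↭ₛ (↭.↭-sym P↭T)) (proj₁ inL)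
  unique₂ : Unique (map proj₂ P)
  unique₂ = subst Unique (sym P≡T′) (proj₁ inL′)

type-↭ : ∀ {n n′} d d′ {T : List (Subset n)} {T′ : List (Subset n′)} → type d T ≡ type d′ T′ →
         map (λ X → suc d ℕ.∸ ∣ X ∣) T ↭ map (λ X → suc d′ ℕ.∸ ∣ X ∣) T′
type-↭ d d′ {T} {T′} types≡ = begin
  map (λ X → suc d ℕ.∸ ∣ X ∣) T       ↭⟨ sort-↭ _ ⟨
  sort (map (λ X → suc d ℕ.∸ ∣ X ∣) T) ↭⟨ ↭.↭-reverse _ ⟨
  type d T                           ≡⟨ types≡ ⟩
  type d′ T′                         ↭⟨ ↭.↭-reverse _ ⟩
  sort (map (λ X → suc d′ ℕ.∸ ∣ X ∣) T′) ↭⟨ sort-↭ _ ⟩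
  map (λ X → suc d′ ℕ.∸ ∣ X ∣) T′      ∎
  where open ↭.PermutationReasoning

∣∁p∣≡k+[1+d∸∣p∣] : ∀ d k (p : Subset (d + k + 1)) → ∣ p ∣ ≤ suc d → ∣ ∁ p ∣ ≡ k + (suc d ℕ.∸ ∣ p ∣)
∣∁p∣≡k+[1+d∸∣p∣] d k p |p|≤1+d = begin
  ∣ ∁ p ∣                      ≡⟨ ∣∁p∣≡n∸∣p∣ p ⟩
  d + k + 1 ℕ.∸ ∣ p ∣        ≡⟨ cong (ℕ._∸ ∣ p ∣) d+k+1≡k+[1+d] ⟩
  k + suc d ℕ.∸ ∣ p ∣          ≡⟨ ℕ.+-∸-assoc k |p|≤1+d ⟩
  k + (suc d ℕ.∸ ∣ p ∣)        ∎
  where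
  open ≡-Reasoning
  d+k+1≡k+[1+d] : d + k + 1 ≡ k + suc d
  d+k+1≡k+[1+d] = trans (ℕ.+-comm (d + k) 1) (trans (cong suc (ℕ.+-comm d k)) (sym (ℕ.+-suc k d)))

-- The only use of n = d + k + 1: the complement of p has k + codim p points.
codim-matched : ∀ k d d′ {p : Subset (d + k + 1)} {p′ : Subset (d′ + k + 1)} → ∣ p ∣ ≤ d → ∣ p′ ∣ ≤ d′ →
                suc d ℕ.∸ ∣ p ∣ ≡ suc d′ ℕ.∸ ∣ p′ ∣ → codim d p ≡ codim d′ p′ × ∣ ∁ p ∣ ≡ ∣ ∁ p′ ∣
codim-matched k d d′ {p} {p′} |p|≤d |p′|≤d′ codims≡ =
  trans (codim≡+∸ d p |p|≤1+d) (trans (cong +_ codims≡) (sym (codim≡+∸ d′ p′ |p′|≤1+d′))) ,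
  trans (∣∁p∣≡k+[1+d∸∣p∣] d k p |p|≤1+d)
        (trans (cong (λ c → k + c) codims≡) (sym (∣∁p∣≡k+[1+d∸∣p∣] d′ k p′ |p′|≤1+d′)))
  where
  |p|≤1+d = ℕ.m≤n⇒m≤1+n |p|≤d
  |p′|≤1+d′ = ℕ.m≤n⇒m≤1+n |p′|≤d′

μ-≡-from-pairing : ∀ k d d′ {T : List (Subset (d + k + 1))} {T′ : List (Subset (d′ + k + 1))} →
  InL (d + k + 1) d T → InL (d′ + k + 1) d′ T′ → (P : List (Subset (d + k + 1) × Subset (d′ + k + 1))) →
  map proj₁ P ↭ T → map proj₂ P ≡ T′ → All (λ (p , p′) → suc d ℕ.∸ ∣ p ∣ ≡ suc d′ ℕ.∸ ∣ p′ ∣) P →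
  μ (d + k + 1) d T ≡ μ (d′ + k + 1) d′ T′
μ-≡-from-pairing k d d′ {T} inL inL′ P P↭T P≡T′ codims≡ =
  MöbiusTransport.μ-transport M (Families.FamCorr-pieces M) (Refines-refl T)
  where
  matched : ∀ {a} → a ∈ P → codim d (proj₁ a) ≡ codim d′ (proj₂ a) × ∣ ∁ (proj₁ a) ∣ ≡ ∣ ∁ (proj₂ a) ∣
  matched {p , p′} a∈P = codim-matched k d d′ {p} {p′}
    (All.lookup (Admissible.bounded (InL⇒Admissible inL)) (↭.∈-resp-↭ P↭T (∈-map⁺ proj₁ a∈P)))
    (All.lookup (Admissible.bounded (InL⇒Admissible inL′)) (subst (_ ∈_) P≡T′ (∈-map⁺ proj₂ a∈P)))
    (All.lookup codims≡ a∈P)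
  M = Matching-from-pairs inL inL′ P P↭T P≡T′ (All.tabulate matched)

corollary16 : (k d d′ : ℕ) → 1 ≤ d′ → d′ ≤ d → (γ : List ℕ) →
    (∃ λ (T₀ : List (Subset (d′ + k + 1))) → InL (d′ + k + 1) d′ T₀ × type d′ T₀ ≡ γ) →
    (T : List (Subset (d + k + 1))) → InL (d + k + 1) d T → type d T ≡ γ →
    (T′ : List (Subset (d′ + k + 1))) → InL (d′ + k + 1) d′ T′ → type d′ T′ ≡ γ →
    μ (d + k + 1) d T ≡ μ (d′ + k + 1) d′ T′
corollary16 k d d′ _ _ _ _ T inL typeT T′ inL′ typeT′ =
  let P , P↭T , P≡T′ , codims≡ = pair-up _ _ (type-↭ d d′ (trans typeT (sym typeT′)))
  in μ-≡-from-pairing k d d′ inL inL′ P P↭T P≡T′ codims≡
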